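{- Consider the EXAM instantiated with an arbitrary pool template. If $s\to_o s'$ (i.e. $s$ steps to $s'$ by one of the transitions $\mathtt{sea}_@$, $\mathtt{sub}$, $\mathtt{sea}_\lambda$, $\mathtt{sea}_{\mathcal V}$), then $\mathrm{rb}(s)=\mathrm{rb}(s')$.
   Context: Pre-terms $t ::= x\mid\lambda x.t\mid t\,t$ (no implicit $\alpha$-renaming; equality of read-backs is up to $\alpha$); $t\{x:=u\}$ is capture-avoiding substitution; a pre-term is well-named if its bound variables are pairwise distinct. Stacks $S ::= \epsilon\mid t:S$. Environments $E ::= \epsilon\mid[x\leftarrow t]:E$; $\mathrm{dom}(E)$, and $E(x)$ the pre-term of the (leftmost) entry for $x$. Named multi-contexts $\mathbb{C} ::= x\mid\langle\cdot\rangle_\alpha\mid\lambda x.\mathbb{C}\mid\mathbb{C}\,\mathbb{C}$; $\mathbb{C}\{\alpha\leftarrow\mathbb{C}'\}$ is capture-allowing replacement of $\langle\cdot\rangle_\alpha$. Approximants $\mathbb{B} ::= \langle\cdot\rangle_\alpha\mid\mathbb{R}\mid\lambda x.\mathbb{B}$, $\mathbb{R} ::= x\mid\mathbb{R}\,\mathbb{B}$. Jobs $(t,S)_\alpha$. Pool templates provide pools $P$ with a finite set $\mathrm{names}(P)$, a support $\mathrm{supp}(P)$ of jobs indexed bijectively by $\mathrm{names}(P)$, $\mathrm{new}(j_\alpha)$ with support $\{j_\alpha\}$, a selection relation $\mathrm{sel}(P,j_\alpha,P')$ with $j_\alpha\in\mathrm{supp}(P)$ and $\mathrm{supp}(P')=\mathrm{supp}(P)\setminus\{j_\alpha\}$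 (some selection existing when the support is nonempty), and functions $\mathrm{drop}(j_\alpha,P)$, $\mathrm{add}(j_\alpha,P)$ defined for $\alpha\notin\mathrm{names}(P)$ with support $\mathrm{supp}(P)\cup\{j_\alpha\}$; $\mathrm{add}$ extends to lists by adding elements left to right. EXAM transitions from $(\mathbb{B},P,E)$, after selecting $\mathrm{sel}(P,j_\alpha,P')$: ($\mathtt{sea}_@$) $j_\alpha=(t\,u,S)_\alpha$ gives $(\mathbb{B},\mathrm{drop}((t,u:S)_\alpha,P'),E)$; ($\beta$) $j_\alpha=(\lambda x.t,u:S)_\alpha$ gives $(\mathbb{B},\mathrm{drop}((t,S)_\alpha,P'),[x\leftarrow u]:E)$; ($\mathtt{sub}$) $j_\alpha=(x,S)_\alpha$, $x\in\mathrm{dom}(E)$, gives $(\mathbb{B},\mathrm{drop}((t',S)_\alpha,P'),E)$ with $t'$ a fresh well-named renaming of $E(x)$; ($\mathtt{sea}_\lambda$) $j_\alpha=(\lambda x.t,\epsilon)_\alpha$ gives $(\mathbb{B}\{\alpha\leftarrow\lambda x.\langle\cdot\rangle_\alpha\},\mathrm{drop}((t,\epsilon)_\alpha,P'),E)$; ($\mathtt{sea}_{\mathcal V}$) $j_\alpha=(x,t_1:\dots:t_n)_\alpha$, $n\ge0$, $x\notin\mathrm{dom}(E)$, gives $(\mathbb{B}\{\alpha\leftarrow x\,\langle\cdot\rangle_{\beta_1}\cdots\langle\cdot\rangle_{\beta_n}\},\mathrm{add}((t_1,\epsilon)_{\beta_1}:\dots:(t_n,\epsilon)_{\beta_n},P'),E)$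 with fresh $\beta_i$. Read-back: $t\downarrow\epsilon:=t$, $t\downarrow([x\leftarrow u]:E):=(t\{x:=u\})\downarrow E$; stacks pointwise; $\langle t\mid\epsilon\rangle:=t$, $\langle t\mid u:S\rangle:=\langle t\,u\mid S\rangle$; $(t,S)_\alpha\downarrow E:=(t\downarrow E,S\downarrow E)_\alpha$, lifted to sets; $\mathrm{rb}((t,S)_\alpha):=\langle t\mid S\rangle$; $\mathbb{C}_X:=\mathbb{C}\{\alpha_1\leftarrow\mathrm{rb}(j_{\alpha_1})\}\cdots\{\alpha_n\leftarrow\mathrm{rb}(j_{\alpha_n})\}$ for $X=\{j_{\alpha_1},\dots,j_{\alpha_n}\}$ with distinct names; $\mathrm{rb}((\mathbb{B},P,E)):=\mathbb{B}_{\mathrm{supp}(P)\downarrow E}$ (a multi-context). -}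

module Defs where

open import Data.Nat using (ℕ; suc; _⊔_; _≟_; _≡ᵇ_)
open import Data.Bool using (Bool; true; false; if_then_else_)
open import Data.List using (List; []; _∷_; map; foldr; foldl; filter; concatMap; length; zipWith; _++_)
open import Data.List.Membership.Propositional using (_∈_; _∉_)
open import Data.List.Relation.Unary.All using (All)
open import Data.List.Relation.Unary.Unique.Propositional using (Unique)
open import Data.Maybe using (Maybe; just; nothing)
open import Data.Product using (Σ; _×_; _,_; proj₁)
open import Relation.Nullary using (¬_; ¬?)
open import Relation.Binary.PropositionalEquality using (_≡_; _≢_)
open import Relation.Binary.Construct.Closure.ReflexiveTransitive using (Star)
open import Function.Bundles using (_⇔_)

Var : Set
Var = ℕ

Name : Set
Name = ℕ

-- Pre-terms (no implicit α-renaming).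
data Tm : Set where
  var : Var → Tm
  lam : Var → Tm → Tm
  app : Tm → Tm → Tm

fv : Tm → List Var
fv (var x)   = x ∷ []
fv (lam y t) = filter (λ w → ¬? (w ≟ y)) (fv t)
fv (app t u) = fv t ++ fv u

bv : Tm → List Var
bv (var x)   = []
bv (lam y t) = y ∷ bv t
bv (app t u) = bv t ++ bv u

vars : Tm → List Var
vars (var x)   = x ∷ []
vars (lam y t) = y ∷ vars t
vars (app t u) = vars t ++ vars u

WellNamed : Tm → Set
WellNamed t = Unique (bv t)

maxL : List ℕ → ℕ
maxL = foldr _⊔_ 0

_[_↦_] : (Var → Tm) → Var → Tm → (Var → Tm)
(σ [ y ↦ u ]) w = if w ≡ᵇ y then u else σ w

-- Capture-avoiding simultaneous substitution (Stoughton style): every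
-- binder is renamed to a variable fresh for the relevant part of σ.
-- The result is capture-avoiding substitution, determined up to α.
ssub : (Var → Tm) → Tm → Tm
ssub σ (var x)   = σ x
ssub σ (app t u) = app (ssub σ t) (ssub σ u)
ssub σ (lam y t) =
  lam z (ssub (σ [ y ↦ var z ]) t)
  where z = suc (maxL (concatMap (λ w → fv (σ w)) (fv (lam y t))))

_⟦_≔_⟧ : Tm → Var → Tm → Tm
t ⟦ x ≔ u ⟧ = ssub (var [ x ↦ u ]) t

Stack : Set
Stack = List Tm

Env : Set
Env = List (Var × Tm)

dom : Env → List Var
dom = map proj₁

lookupE : Env → Var → Maybe Tm
lookupE []             x = nothing
lookupE ((y , u) ∷ E) x = if x ≡ᵇ y then just u else lookupE E x

record Job : Set where
  constructor job
  field
    jtm   : Tm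
    jstk  : Stack
    jname : Name
open Job public

data MC : Set where
  var  : Var → MC
  hole : Name → MC
  lam  : Var → MC → MC
  app  : MC → MC → MC

toMC : Tm → MC
toMC (var x)   = var x
toMC (lam x t) = lam x (toMC t)
toMC (app t u) = app (toMC t) (toMC u)

_⟮_←_⟯ : MC → Name → MC → MC
var x   ⟮ α ← C' ⟯ = var x
hole β  ⟮ α ← C' ⟯ = if β ≡ᵇ α then C' else hole β
lam x C ⟮ α ← C' ⟯ = lam x (C ⟮ α ← C' ⟯)
app C D ⟮ α ← C' ⟯ = app (C ⟮ α ← C' ⟯) (D ⟮ α ← C' ⟯)

holes : MC → List Name
holes (var x)   = []
holes (hole α)  = α ∷ []
holes (lam x C) = holes C
holes (app C D) = holes C ++ holes D

varsMC : MC → List Var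
varsMC (var x)   = x ∷ []
varsMC (hole α)  = []
varsMC (lam x C) = x ∷ varsMC C
varsMC (app C D) = varsMC C ++ varsMC D

data _∋_↔_ : List (Var × Var) → Var → Var → Set where
  nil   : ∀ {x} → [] ∋ x ↔ x
  here  : ∀ {Γ x y} → ((x , y) ∷ Γ) ∋ x ↔ y
  there : ∀ {Γ x y a b} → x ≢ a → y ≢ b → Γ ∋ x ↔ y → ((a , b) ∷ Γ) ∋ x ↔ y

data _⊢_~α_ : List (Var × Var) → MC → MC → Set where
  var  : ∀ {Γ x y} → Γ ∋ x ↔ y → Γ ⊢ var x ~α var y
  hole : ∀ {Γ α} → Γ ⊢ hole α ~α hole α
  lam  : ∀ {Γ x y C D} → ((x , y) ∷ Γ) ⊢ C ~α D → Γ ⊢ lam x C ~α lam y D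
  app  : ∀ {Γ C C' D D'} → Γ ⊢ C ~α C' → Γ ⊢ D ~α D' → Γ ⊢ app C D ~α app C' D'

_≈α_ : MC → MC → Set
C ≈α D = [] ⊢ C ~α D

_↓_ : Tm → Env → Tm
t ↓ []            = t
t ↓ ((x , u) ∷ E) = (t ⟦ x ≔ u ⟧) ↓ E

_↓S_ : Stack → Env → Stack
S ↓S E = map (_↓ E) S

⟨_∣_⟩ : Tm → Stack → Tm
⟨ t ∣ [] ⟩    = t
⟨ t ∣ u ∷ S ⟩ = ⟨ app t u ∣ S ⟩

_↓J_ : Job → Env → Job
job t S α ↓J E = job (t ↓ E) (S ↓S E) α

rbJ : Job → Tm
rbJ (job t S α) = ⟨ t ∣ S ⟩

-- C_X for a finite set X of jobs (given as a list)
plugJobs : MC → List Job → MC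
plugJobs C []       = C
plugJobs C (j ∷ js) = plugJobs (C ⟮ jname j ← toMC (rbJ j) ⟯) js

_≋_ : List Job → List Job → Set
X ≋ Y = ∀ k → (k ∈ X) ⇔ (k ∈ Y)

record PoolTemplate : Set₁ where
  field
    Pool        : Set
    supp        : Pool → List Job
    -- supp is indexed bijectively by names(P): names are pairwise distinct
    supp-unique : ∀ P → Unique (map jname (supp P))
    new         : Job → Pool
    new-supp    : ∀ j → supp (new j) ≋ (j ∷ [])
    Sel         : Pool → Job → Pool → Set
    sel-mem     : ∀ {P j P'} → Sel P j P' → j ∈ supp P
    sel-supp    : ∀ {P j P'} → Sel P j P' →
                  ∀ k → (k ∈ supp P') ⇔ ((k ∈ supp P) × k ≢ j)
    sel-exists  : ∀ P → supp P ≢ [] → Σ Job (λ j → Σ Pool (λ P' → Sel P j P'))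
    -- drop/add: specified on their domain (fresh name)
    drop        : Job → Pool → Pool
    drop-supp   : ∀ j P → jname j ∉ map jname (supp P) → supp (drop j P) ≋ (j ∷ supp P)
    add         : Job → Pool → Pool
    add-supp    : ∀ j P → jname j ∉ map jname (supp P) → supp (add j P) ≋ (j ∷ supp P)

  names : Pool → List Name
  names P = map jname (supp P)

  addL : List Job → Pool → Pool
  addL []       P = P
  addL (j ∷ js) P = addL js (add j P)

module _ (T : PoolTemplate) where
  open PoolTemplate T

  record State : Set where
    constructor ⟪_,_,_⟫
    field
      ctx  : MC
      pool : Pool
      env  : Env

  varsJob : Job → List Var
  varsJob (job t S α) = vars t ++ concatMap vars S

  varsEnv : Env → List Var
  varsEnv E = dom E ++ concatMap (λ p → vars (Data.Product.proj₂ p)) E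

  stateVars : State → List Var
  stateVars ⟪ B , P , E ⟫ = varsMC B ++ concatMap varsJob (supp P) ++ varsEnv E

  FreshRenaming : State → Tm → Tm → Set
  FreshRenaming s u t' =
    (toMC t' ≈α toMC u) × WellNamed t' × All (λ y → y ∉ stateVars s) (bv t')

  appHoles : MC → List Name → MC
  appHoles = foldl (λ C β → app C (hole β))

  data OStep : State → State → Set where
    seaApp : ∀ {B P P' E t u S α} → Sel P (job (app t u) S α) P' →
             OStep ⟪ B , P , E ⟫ ⟪ B , drop (job t (u ∷ S) α) P' , E ⟫
    sub    : ∀ {B P P' E x u t' S α} → Sel P (job (var x) S α) P' →
             lookupE E x ≡ just u →
             FreshRenaming ⟪ B , P , E ⟫ u t' →
             OStep ⟪ B , P , E ⟫ ⟪ B , drop (job t' S α) P' , E ⟫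
    seaLam : ∀ {B P P' E x t α} → Sel P (job (lam x t) [] α) P' →
             OStep ⟪ B , P , E ⟫
                   ⟪ B ⟮ α ← lam x (hole α) ⟯ , drop (job t [] α) P' , E ⟫
    seaVar : ∀ {B P P' E x ts α} (βs : List Name) →
             Sel P (job (var x) ts α) P' →
             lookupE E x ≡ nothing →
             length βs ≡ length ts →
             Unique βs →
             All (λ β → β ∉ names P × β ∉ holes B) βs →
             OStep ⟪ B , P , E ⟫
                   ⟪ B ⟮ α ← appHoles (var x) βs ⟯
                   , addL (zipWith (λ t β → job t [] β) ts βs) P' , E ⟫

  data BStep : State → State → Set where
    beta : ∀ {B P P' E x t u S α} → Sel P (job (lam x t) (u ∷ S) α) P' →
           BStep ⟪ B , P , E ⟫ ⟪ B , drop (job t S α) P' , (x , u) ∷ E ⟫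

  data Step (s s' : State) : Set where
    o : OStep s s' → Step s s'
    b : BStep s s' → Step s s'

  Initial : State → Set
  Initial s = Σ Tm (λ t → Σ Name (λ α →
                (s ≡ ⟪ hole α , new (job t [] α) , [] ⟫) ×
                WellNamed t × All (λ y → y ∉ fv t) (bv t)))

  Reachable : State → Set
  Reachable s' = Σ State (λ s → Initial s × Star Step s s')

  rb : State → MC
  rb ⟪ B , P , E ⟫ = plugJobs B (map (_↓J E) (supp P))

-- The read-back fills every hole α of B with the read-back ⟨t ↓ E ∣ S ↓ E⟩ of the job named α.
-- An o-transition only touches the selected job: it either replaces it by a job of the same name,
-- or refines the hole α of B by a context whose new holes are filled by the new jobs. So it is
-- enough that the new content of α reads back α-equivalently to the old job. For sea_@ this is
-- immediate, and for sea_V because ↓ E fixes a variable outside dom(E). For sub and sea_λ,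
-- read-back commutes with renaming and with the binder only under Barendregt's convention for
-- reachable states: bound variables of jobs are pairwise distinct, free nowhere, and neither bound
-- nor free in E, and no value in E mentions the variable of its own or an earlier entry. Every
-- transition, β included, preserves this, since new bound variables come from the selected job
-- or from a fresh renaming.

module Submission where

open import Data.Bool using (true; false; if_then_else_)
open import Data.Bool.Properties using (T-≡)
open import Data.Empty using (⊥-elim)
open import Data.List using (List; []; _∷_; map; concatMap; zipWith; length; _++_)
open import Data.List.Properties using (++-assoc; ++-identityʳ; map-∘)
open import Data.List.Membership.Propositional using (_∈_; _∉_; find; lose)
open import Data.List.Membership.Propositional.Properties
  using (∉[]; ∈-++⁺ˡ; ∈-++⁺ʳ; ∈-++⁻; ∈-map⁺; ∈-map⁻; ∈-concatMap⁺; ∈-concatMap⁻; ∈-filter⁺; ∈-filter⁻)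
open import Data.List.Relation.Binary.Disjoint.Propositional using (Disjoint)
open import Data.List.Relation.Binary.Subset.Propositional using (_⊆_)
open import Data.List.Relation.Unary.All as All using (All; _∷_)
open import Data.List.Relation.Unary.Any using (here; there)
open import Data.List.Relation.Unary.AllPairs as AllPairs using ([]; _∷_)
open import Data.List.Relation.Unary.Unique.Propositional using (Unique)
open import Data.List.Relation.Unary.Unique.Propositional.Properties using (++⁺; Unique[x∷xs]⇒x∉xs)
open import Data.Maybe using (Maybe; just; nothing)
open import Data.Maybe.Properties using (just-injective)
open import Data.Maybe.Relation.Binary.Pointwise as Pointwise using (Pointwise; just; nothing)
open import Data.Nat using (suc; _≤_; s≤s; _≟_; _≡ᵇ_)
open import Data.Nat.Properties using (≡ᵇ⇒≡; ≡⇒≡ᵇ; ≤-trans; m≤m⊔n; m≤n⊔m; n≮n; suc-injective)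
open import Data.Product using (∃; _×_; _,_; proj₁; proj₂; swap)
open import Data.Sum using (_⊎_; inj₁; inj₂)
open import Data.Unit using (⊤; tt)
open import Function using (_∘_)
open import Function.Bundles using (Equivalence)
open import Relation.Binary.Construct.Closure.ReflexiveTransitive using (Star; ε; _◅_)
open import Relation.Nullary using (¬_; ¬?; yes; no)
open import Relation.Binary.PropositionalEquality using (_≡_; _≢_; refl; sym; trans; cong; cong₂; subst; module ≡-Reasoning)

open import Defs

open Equivalence using (to; from)

≡ᵇ-refl : ∀ n → (n ≡ᵇ n) ≡ true
≡ᵇ-refl n = to T-≡ (≡⇒≡ᵇ n n refl)

≡ᵇ-true⇒≡ : ∀ m n → (m ≡ᵇ n) ≡ true → m ≡ n
≡ᵇ-true⇒≡ m n e = ≡ᵇ⇒≡ m n (from T-≡ e)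

≢⇒≡ᵇ-false : ∀ m n → m ≢ n → (m ≡ᵇ n) ≡ false
≢⇒≡ᵇ-false m n m≢n with m ≡ᵇ n in eq
... | false = refl
... | true  = ⊥-elim (m≢n (≡ᵇ-true⇒≡ m n eq))

update-same : ∀ (σ : Var → Tm) y u → (σ [ y ↦ u ]) y ≡ u
update-same σ y u rewrite ≡ᵇ-refl y = refl

update-other : ∀ (σ : Var → Tm) y u w → w ≢ y → (σ [ y ↦ u ]) w ≡ σ w
update-other σ y u w w≢y rewrite ≢⇒≡ᵇ-false w y w≢y = refl

module _ {A : Set} where

  Unique-++⁻ : ∀ (xs : List A) {ys} → Unique (xs ++ ys) → Unique xs × Unique ys × Disjoint xs ys
  Unique-++⁻ []       u           = [] , u , λ { (() , _) }
  Unique-++⁻ (x ∷ xs) (x∉ ∷ u) with Unique-++⁻ xs u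
  ... | uxs , uys , xs#ys =
    All.tabulate (λ p → All.lookup x∉ (∈-++⁺ˡ p)) ∷ uxs , uys ,
    λ { (here refl , q) → All.lookup x∉ (∈-++⁺ʳ xs q) refl ; (there p , q) → xs#ys (p , q) }

  Unique-++-drop-middle : ∀ (xs ys : List A) {zs} → Unique (xs ++ ys ++ zs) → Unique (xs ++ zs)
  Unique-++-drop-middle xs ys u with Unique-++⁻ xs u
  ... | uxs , uyzs , xs#yzs =
    ++⁺ uxs (proj₁ (proj₂ (Unique-++⁻ ys uyzs))) λ (p , q) → xs#yzs (p , ∈-++⁺ʳ ys q)

  ∈-++-[] : ∀ {x : A} xs → x ∈ xs ++ [] → x ∈ xs
  ∈-++-[] {x} xs = subst (x ∈_) (++-identityʳ xs)

  ∈-∷-tail : ∀ {x y : A} {xs} → x ≢ y → x ∈ y ∷ xs → x ∈ xs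
  ∈-∷-tail x≢y (here x≡y) = ⊥-elim (x≢y x≡y)
  ∈-∷-tail _   (there p)  = p

module _ {A B : Set} where

  ∈-concatMap-intro : ∀ (f : A → List B) {x y xs} → x ∈ xs → y ∈ f x → y ∈ concatMap f xs
  ∈-concatMap-intro f p q = ∈-concatMap⁺ f (lose {P = λ x → _ ∈ f x} p q)

  ∈-concatMap-elim : ∀ (f : A → List B) {y} xs → y ∈ concatMap f xs → ∃ λ x → x ∈ xs × y ∈ f x
  ∈-concatMap-elim f xs p = find (∈-concatMap⁻ f {xs} p)

  concatMap-mono : ∀ (f g : A → List B) → (∀ x → f x ⊆ g x) → ∀ xs → concatMap f xs ⊆ concatMap g xs
  concatMap-mono f g f⊆g xs p with ∈-concatMap-elim f xs p
  ... | x , x∈xs , q = ∈-concatMap-intro g x∈xs (f⊆g x q)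

≤-maxL : ∀ {v} L → v ∈ L → v ≤ maxL L
≤-maxL (x ∷ L) (here refl) = m≤m⊔n x (maxL L)
≤-maxL (x ∷ L) (there p)   = ≤-trans (≤-maxL L p) (m≤n⊔m x (maxL L))

maxL-fresh : ∀ (f : Var → List Var) L {w v} → w ∈ L → v ∈ f w → v ≢ suc (maxL (concatMap f L))
maxL-fresh f L {v = v} w∈L v∈fw refl =
  n≮n v (s≤s (≤-maxL (concatMap f L) (∈-concatMap-intro f w∈L v∈fw)))

∈-∷-unless-head : ∀ {xs} w y → (w ≢ y → w ∈ xs) → w ∈ y ∷ xs
∈-∷-unless-head w y w∈ with w ≟ y
... | yes w≡y = here w≡y
... | no  w≢y = there (w∈ w≢y)

∈-fv-lam⁻ : ∀ {w y t} → w ∈ fv (lam y t) → w ∈ fv t × w ≢ y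
∈-fv-lam⁻ {y = y} = ∈-filter⁻ (λ w → ¬? (w ≟ y))

∈-fv-lam⁺ : ∀ {w y t} → w ∈ fv t → w ≢ y → w ∈ fv (lam y t)
∈-fv-lam⁺ {y = y} = ∈-filter⁺ (λ w → ¬? (w ≟ y))

Ctx : Set
Ctx = List (Var × Var)

infix 4 _⊢_≃_
_⊢_≃_ : Ctx → Tm → Tm → Set
Γ ⊢ s ≃ t = Γ ⊢ toMC s ~α toMC t

↔-functional : ∀ {Γ x y y'} → Γ ∋ x ↔ y → Γ ∋ x ↔ y' → y ≡ y'
↔-functional nil             nil             = refl
↔-functional here            here            = refl
↔-functional here            (there x≢x _ _) = ⊥-elim (x≢x refl)
↔-functional (there x≢x _ _) here            = ⊥-elim (x≢x refl)
↔-functional (there _ _ p)   (there _ _ q)   = ↔-functional p q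

data Diagonal : Ctx → Set where
  []  : Diagonal []
  _∷_ : ∀ {Γ} x → Diagonal Γ → Diagonal ((x , x) ∷ Γ)

↔-diagonal : ∀ {Γ} → Diagonal Γ → ∀ x → Γ ∋ x ↔ x
↔-diagonal []      x = nil
↔-diagonal (a ∷ I) x with x ≟ a
... | yes refl = here
... | no  x≢a  = there x≢a x≢a (↔-diagonal I x)

~α-refl : ∀ {Γ} → Diagonal Γ → ∀ C → Γ ⊢ C ~α C
~α-refl I (var x)   = var (↔-diagonal I x)
~α-refl I (hole α)  = hole
~α-refl I (lam x C) = lam (~α-refl (x ∷ I) C)
~α-refl I (app C D) = app (~α-refl I C) (~α-refl I D)

↔-++-diagonal : ∀ {Θ Γ x y} → Diagonal Γ → Θ ∋ x ↔ y → (Θ ++ Γ) ∋ x ↔ y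
↔-++-diagonal I nil             = ↔-diagonal I _
↔-++-diagonal I here            = here
↔-++-diagonal I (there x≢ y≢ p) = there x≢ y≢ (↔-++-diagonal I p)

~α-++-diagonal : ∀ {Θ Γ C D} → Diagonal Γ → Θ ⊢ C ~α D → (Θ ++ Γ) ⊢ C ~α D
~α-++-diagonal I (var p)   = var (↔-++-diagonal I p)
~α-++-diagonal I hole      = hole
~α-++-diagonal I (lam d)   = lam (~α-++-diagonal I d)
~α-++-diagonal I (app d e) = app (~α-++-diagonal I d) (~α-++-diagonal I e)

↔-sym : ∀ {Γ x y} → Γ ∋ x ↔ y → map swap Γ ∋ y ↔ x
↔-sym nil             = nil
↔-sym here            = here
↔-sym (there x≢ y≢ p) = there y≢ x≢ (↔-sym p)

~α-sym : ∀ {Γ C D} → Γ ⊢ C ~α D → map swap Γ ⊢ D ~α C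
~α-sym (var p)   = var (↔-sym p)
~α-sym hole      = hole
~α-sym (lam d)   = lam (~α-sym d)
~α-sym (app d e) = app (~α-sym d) (~α-sym e)

data Composite : Ctx → Ctx → Ctx → Set where
  []   : Composite [] [] []
  cons : ∀ {Γ Δ Θ} x y z → Composite Γ Δ Θ → Composite ((x , y) ∷ Γ) ((y , z) ∷ Δ) ((x , z) ∷ Θ)

↔-trans : ∀ {Γ Δ Θ x y z} → Composite Γ Δ Θ → Γ ∋ x ↔ y → Δ ∋ y ↔ z → Θ ∋ x ↔ z
↔-trans []             nil             nil             = nil
↔-trans (cons _ _ _ c) here            here            = here
↔-trans (cons _ _ _ c) here            (there y≢y _ _) = ⊥-elim (y≢y refl)
↔-trans (cons _ _ _ c) (there _ y≢y _) here            = ⊥-elim (y≢y refl)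
↔-trans (cons _ _ _ c) (there x≢ _ p)  (there _ z≢ q)  = there x≢ z≢ (↔-trans c p q)

~α-trans : ∀ {Γ Δ Θ C D E} → Composite Γ Δ Θ → Γ ⊢ C ~α D → Δ ⊢ D ~α E → Θ ⊢ C ~α E
~α-trans c (var p)    (var q)    = var (↔-trans c p q)
~α-trans c hole       hole       = hole
~α-trans c (lam d)    (lam e)    = lam (~α-trans (cons _ _ _ c) d e)
~α-trans c (app d d') (app e e') = app (~α-trans c d e) (~α-trans c d' e')

≈α-refl : ∀ {C} → C ≈α C
≈α-refl {C} = ~α-refl [] C

≈α-reflexive : ∀ {C D} → C ≡ D → C ≈α D
≈α-reflexive refl = ≈α-refl

≈α-sym : ∀ {C D} → C ≈α D → D ≈α C
≈α-sym = ~α-sym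

≈α-trans : ∀ {C D E} → C ≈α D → D ≈α E → C ≈α E
≈α-trans = ~α-trans []

fv-≃ : ∀ {Γ} s s' → Γ ⊢ s ≃ s' → ∀ {w} → w ∈ fv s → ∃ λ w' → (Γ ∋ w ↔ w') × w' ∈ fv s'
fv-≃ (var x)   (var y)     (var p) (here refl) = y , p , here refl
fv-≃ (lam y t) (lam y' t') (lam d) w∈ with ∈-fv-lam⁻ {t = t} w∈
... | w∈t , w≢y with fv-≃ t t' d w∈t
...   | w' , here , _                = ⊥-elim (w≢y refl)
...   | w' , there _ w'≢y' p , w'∈t' = w' , p , ∈-fv-lam⁺ {t = t'} w'∈t' w'≢y'
fv-≃ (app t u) (app t' u') (app d e) w∈ with ∈-++⁻ (fv t) w∈
... | inj₁ p = let w' , q , r = fv-≃ t t' d p in w' , q , ∈-++⁺ˡ r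
... | inj₂ p = let w' , q , r = fv-≃ u u' e p in w' , q , ∈-++⁺ʳ (fv t') r

∉fv-≃ : ∀ {s s' w} → [] ⊢ s ≃ s' → w ∉ fv s' → w ∉ fv s
∉fv-≃ {s} {s'} d w∉ w∈ with fv-≃ s s' d w∈
... | _ , nil , w∈s' = w∉ w∈s'

↔-weaken : ∀ Θ {Δ a b x y} → (Θ ++ Δ) ∋ x ↔ y →
           (x ≡ a → x ∈ map proj₁ Θ) → (y ≡ b → y ∈ map proj₂ Θ) →
           (Θ ++ (a , b) ∷ Δ) ∋ x ↔ y
↔-weaken []      p ha hb = there (∉[] ∘ ha) (∉[] ∘ hb) p
↔-weaken (_ ∷ Θ) here ha hb = here
↔-weaken (_ ∷ Θ) (there x≢ y≢ p) ha hb =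
  there x≢ y≢ (↔-weaken Θ p (∈-∷-tail x≢ ∘ ha) (∈-∷-tail y≢ ∘ hb))

≃-weaken : ∀ Θ {Δ a b} s s' → (Θ ++ Δ) ⊢ s ≃ s' →
           (∀ {w} → w ∈ fv s  → w ≡ a → w ∈ map proj₁ Θ) →
           (∀ {w} → w ∈ fv s' → w ≡ b → w ∈ map proj₂ Θ) →
           (Θ ++ (a , b) ∷ Δ) ⊢ s ≃ s'
≃-weaken Θ (var x)   (var y)     (var p) ha hb = var (↔-weaken Θ p (ha (here refl)) (hb (here refl)))
≃-weaken Θ (lam y t) (lam y' t') (lam d) ha hb =
  lam (≃-weaken ((y , y') ∷ Θ) t t' d
    (λ {w} w∈t e → ∈-∷-unless-head w y  (λ w≢y → ha (∈-fv-lam⁺ {t = t}  w∈t w≢y) e))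
    (λ {w} w∈t e → ∈-∷-unless-head w y' (λ w≢y → hb (∈-fv-lam⁺ {t = t'} w∈t w≢y) e)))
≃-weaken Θ (app t u) (app t' u') (app d e) ha hb =
  app (≃-weaken Θ t t' d (ha ∘ ∈-++⁺ˡ) (hb ∘ ∈-++⁺ˡ))
      (≃-weaken Θ u u' e (ha ∘ ∈-++⁺ʳ (fv t)) (hb ∘ ∈-++⁺ʳ (fv t')))

≃-weaken-∉fv : ∀ {Δ a b} s s' → Δ ⊢ s ≃ s' → a ∉ fv s → b ∉ fv s' → ((a , b) ∷ Δ) ⊢ s ≃ s'
≃-weaken-∉fv s s' d a∉ b∉ =
  ≃-weaken [] s s' d (λ { p refl → ⊥-elim (a∉ p) }) (λ { p refl → ⊥-elim (b∉ p) })

fresh : (Var → Tm) → Var → Tm → Var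
fresh σ y t = suc (maxL (concatMap (λ w → fv (σ w)) (fv (lam y t))))

fresh-∉ : ∀ σ y t {w} → w ∈ fv (lam y t) → fresh σ y t ∉ fv (σ w)
fresh-∉ σ y t w∈ v∈ = maxL-fresh (λ w → fv (σ w)) (fv (lam y t)) w∈ v∈ refl

ssub-≃ : ∀ {Γ Δ} (σ σ' : Var → Tm) s s' → Γ ⊢ s ≃ s' →
         (∀ {w w'} → w ∈ fv s → Γ ∋ w ↔ w' → Δ ⊢ σ w ≃ σ' w') →
         Δ ⊢ ssub σ s ≃ ssub σ' s'
ssub-≃ σ σ' (var x)   (var y)     (var p)   h = h (here refl) p
ssub-≃ σ σ' (app t u) (app t' u') (app d e) h =
  app (ssub-≃ σ σ' t t' d (h ∘ ∈-++⁺ˡ)) (ssub-≃ σ σ' u u' e (h ∘ ∈-++⁺ʳ (fv t)))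
ssub-≃ {Γ} {Δ} σ σ' (lam y t) (lam y' t') (lam d) h =
  lam (ssub-≃ (σ [ y ↦ var z ]) (σ' [ y' ↦ var z' ]) t t' d h')
  where
    z  = fresh σ y t
    z' = fresh σ' y' t'
    h' : ∀ {w w'} → w ∈ fv t → ((y , y') ∷ Γ) ∋ w ↔ w' →
         ((z , z') ∷ Δ) ⊢ (σ [ y ↦ var z ]) w ≃ (σ' [ y' ↦ var z' ]) w'
    h' _ here rewrite update-same σ y (var z) | update-same σ' y' (var z') = var here
    h' {w} {w'} w∈t (there w≢y w'≢y' p)
      rewrite update-other σ y (var z) w w≢y | update-other σ' y' (var z') w' w'≢y' =
      ≃-weaken-∉fv (σ w) (σ' w') (h w∈ p) (fresh-∉ σ y t w∈) (fresh-∉ σ' y' t' w'∈)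
      where
        w∈ = ∈-fv-lam⁺ {t = t} w∈t w≢y
        w'∈ : w' ∈ fv (lam y' t')
        w'∈ with fv-≃ (lam y t) (lam y' t') (lam d) w∈
        ... | _ , p' , q rewrite ↔-functional p p' = q

ssub-renaming-≃ : ∀ {Γ} (σ : Var → Tm) s →
                  (∀ {w} → w ∈ fv s → ∃ λ v → σ w ≡ var v × Γ ∋ v ↔ w) → Γ ⊢ ssub σ s ≃ s
ssub-renaming-≃ σ (var x) h with h (here refl)
... | v , e , p rewrite e = var p
ssub-renaming-≃ σ (app t u) h =
  app (ssub-renaming-≃ σ t (h ∘ ∈-++⁺ˡ)) (ssub-renaming-≃ σ u (h ∘ ∈-++⁺ʳ (fv t)))
ssub-renaming-≃ {Γ} σ (lam y t) h = lam (ssub-renaming-≃ (σ [ y ↦ var z ]) t h')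
  where
    z = fresh σ y t
    h' : ∀ {w} → w ∈ fv t → ∃ λ v → (σ [ y ↦ var z ]) w ≡ var v × ((z , y) ∷ Γ) ∋ v ↔ w
    h' {w} w∈t with w ≟ y
    ... | yes refl = z , update-same σ y (var z) , here
    ... | no w≢y with h (∈-fv-lam⁺ {t = t} w∈t w≢y)
    ...   | v , e , p = v , trans (update-other σ y (var z) w w≢y) e , there v≢z w≢y p
      where
        v≢z : v ≢ z
        v≢z refl =
          fresh-∉ σ y t (∈-fv-lam⁺ {t = t} w∈t w≢y) (subst (λ r → z ∈ fv r) (sym e) (here refl))

⟦≔⟧-∉fv : ∀ t {y v} → y ∉ fv t → [] ⊢ t ⟦ y ≔ v ⟧ ≃ t
⟦≔⟧-∉fv t {y} {v} y∉ = ssub-renaming-≃ (var [ y ↦ v ]) t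
  λ {w} w∈ → w , update-other var y v w (λ { refl → y∉ w∈ }) , nil

↓-≃ : ∀ E {s s'} → [] ⊢ s ≃ s' → [] ⊢ s ↓ E ≃ s' ↓ E
↓-≃ []            d = d
↓-≃ ((x , u) ∷ E) {s} {s'} d =
  ↓-≃ E (ssub-≃ (var [ x ↦ u ]) (var [ x ↦ u ]) s s' d (λ { _ nil → ≈α-refl }))

app-↓ : ∀ E t u → app t u ↓ E ≡ app (t ↓ E) (u ↓ E)
app-↓ []            t u = refl
app-↓ ((x , v) ∷ E) t u = app-↓ E _ _

lam-↓ : ∀ x E t → x ∉ dom E → (∀ {y u} → (y , u) ∈ E → x ∉ fv u) →
        [] ⊢ lam x t ↓ E ≃ lam x (t ↓ E)
lam-↓ x []            t _ _ = ≈α-refl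
lam-↓ x ((y , u) ∷ E) t x∉dom x∉E =
  ≈α-trans (↓-≃ E push) (lam-↓ x E (ssub σ t) (x∉dom ∘ there) (x∉E ∘ there))
  where
    σ = var [ y ↦ u ]
    z = fresh σ x t
    h : ∀ {w w'} → w ∈ fv t → ((x , x) ∷ []) ∋ w ↔ w' →
        ((z , x) ∷ []) ⊢ (σ [ x ↦ var z ]) w ≃ σ w'
    h _ here rewrite update-same σ x (var z) | update-other var y u x (x∉dom ∘ here) = var here
    h {w} w∈t (there w≢x _ nil) rewrite update-other σ x (var z) w w≢x =
      ≃-weaken-∉fv (σ w) (σ w) ≈α-refl (fresh-∉ σ x t (∈-fv-lam⁺ {t = t} w∈t w≢x)) x∉σw
      where
        x∉σw : x ∉ fv (σ w)
        x∉σw with w ≟ y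
        ... | yes refl rewrite update-same var w u = x∉E (here refl)
        ... | no w≢y   rewrite update-other var y u w w≢y = λ { (here e) → w≢x (sym e) }
    push : [] ⊢ ssub σ (lam x t) ≃ lam x (ssub σ t)
    push = lam (ssub-≃ (σ [ x ↦ var z ]) σ t t (~α-refl (x ∷ []) (toMC t)) h)

var-↓ : ∀ E x → lookupE E x ≡ nothing → var x ↓ E ≡ var x
var-↓ []            x _ = refl
var-↓ ((y , v) ∷ E) x e with x ≡ᵇ y
... | false = var-↓ E x e

lookupE-∈ : ∀ E {x u} → lookupE E x ≡ just u → (x , u) ∈ E
lookupE-∈ ((y , v) ∷ E) {x} e with x ≡ᵇ y in eq
... | true  rewrite ≡ᵇ-true⇒≡ x y eq | just-injective e = here refl
... | false = there (lookupE-∈ E e)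

-- Entries to the right of [x ← u] are substituted after it, so they must not reintroduce x.
EnvHygienic : Env → Set
EnvHygienic []            = ⊤
EnvHygienic ((x , u) ∷ E) = EnvHygienic E × x ∉ fv u × (∀ {y v} → (y , v) ∈ E → x ∉ fv v)

↓-lookupE : ∀ E {x u} t → EnvHygienic E → lookupE E x ≡ just u → [] ⊢ t ≃ u →
            [] ⊢ t ↓ E ≃ var x ↓ E
↓-lookupE ((y , v) ∷ E) {x} t (hyg , y∉v , y∉E) look t≃u with x ≡ᵇ y
... | true rewrite just-injective look = ↓-≃ E (≈α-trans (⟦≔⟧-∉fv t (∉fv-≃ t≃u y∉v)) t≃u)
... | false = ↓-lookupE E (t ⟦ y ≔ v ⟧) hyg look
                (≈α-trans (⟦≔⟧-∉fv t (∉fv-≃ t≃u (y∉E (lookupE-∈ E look)))) t≃u)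

⟨∣⟩-≃ : ∀ S {a a'} → [] ⊢ a ≃ a' → [] ⊢ ⟨ a ∣ S ⟩ ≃ ⟨ a' ∣ S ⟩
⟨∣⟩-≃ []      d = d
⟨∣⟩-≃ (u ∷ S) d = ⟨∣⟩-≃ S (app d ≈α-refl)

Filling : Set
Filling = Name → Maybe MC

fillHole : Name → Maybe MC → MC
fillHole α (just M) = M
fillHole α nothing  = hole α

fill : MC → Filling → MC
fill (var x)   ρ = var x
fill (hole α)  ρ = fillHole α (ρ α)
fill (lam x C) ρ = lam x (fill C ρ)
fill (app C D) ρ = app (fill C ρ) (fill D ρ)

fill-nothing : ∀ C → fill C (λ _ → nothing) ≡ C
fill-nothing (var x)   = refl
fill-nothing (hole α)  = refl
fill-nothing (lam x C) = cong (lam x) (fill-nothing C)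
fill-nothing (app C D) = cong₂ app (fill-nothing C) (fill-nothing D)

fill-toMC : ∀ t ρ → fill (toMC t) ρ ≡ toMC t
fill-toMC (var x)   ρ = refl
fill-toMC (lam x t) ρ = cong (lam x) (fill-toMC t ρ)
fill-toMC (app t u) ρ = cong₂ app (fill-toMC t ρ) (fill-toMC u ρ)

extend : Filling → Name → MC → Filling
extend ρ α M β = if β ≡ᵇ α then just M else ρ β

extend-same : ∀ ρ α M → extend ρ α M α ≡ just M
extend-same ρ α M rewrite ≡ᵇ-refl α = refl

extend-other : ∀ ρ α M β → β ≢ α → extend ρ α M β ≡ ρ β
extend-other ρ α M β β≢α rewrite ≢⇒≡ᵇ-false β α β≢α = refl

fill-⟮←⟯ : ∀ C α K ρ → fill (C ⟮ α ← K ⟯) ρ ≡ fill C (extend ρ α (fill K ρ))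
fill-⟮←⟯ (var x)   α K ρ = refl
fill-⟮←⟯ (hole β)  α K ρ with β ≡ᵇ α
... | true  = refl
... | false = refl
fill-⟮←⟯ (lam x C) α K ρ = cong (lam x) (fill-⟮←⟯ C α K ρ)
fill-⟮←⟯ (app C D) α K ρ = cong₂ app (fill-⟮←⟯ C α K ρ) (fill-⟮←⟯ D α K ρ)

fill-cong : ∀ {Γ} → Diagonal Γ → ∀ C {ρ ρ'} →
            (∀ {β} → β ∈ holes C → Pointwise _≈α_ (ρ β) (ρ' β)) → Γ ⊢ fill C ρ ~α fill C ρ'
fill-cong I (var x)   h = var (↔-diagonal I x)
fill-cong I (hole α) {ρ} {ρ'} h with ρ α | ρ' α | h (here refl)
... | just M  | just M' | just M≈M' = ~α-++-diagonal {[]} I M≈M'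
... | nothing | nothing | nothing   = hole
fill-cong I (lam x C) h = lam (fill-cong (x ∷ I) C h)
fill-cong I (app C D) h = app (fill-cong I C (h ∘ ∈-++⁺ˡ)) (fill-cong I D (h ∘ ∈-++⁺ʳ (holes C)))

fill-≈α-at : ∀ B (ρ₁ ρ₂ : Filling) α → (∀ {β} → β ∈ holes B → β ≢ α → ρ₁ β ≡ ρ₂ β) →
             Pointwise _≈α_ (ρ₁ α) (ρ₂ α) → fill B ρ₁ ≈α fill B ρ₂
fill-≈α-at B ρ₁ ρ₂ α agree r = fill-cong [] B at
  where
    at : ∀ {β} → β ∈ holes B → Pointwise _≈α_ (ρ₁ β) (ρ₂ β)
    at {β} β∈ with β ≟ α
    ... | yes refl = r
    ... | no  β≢α  = Pointwise.reflexive ≈α-reflexive (agree β∈ β≢α)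

jobsFilling : List Job → Filling
jobsFilling []      β = nothing
jobsFilling (j ∷ L) β = if β ≡ᵇ jname j then just (toMC (rbJ j)) else jobsFilling L β

-- Job read-backs are hole-free, so plugging them one at a time is a simultaneous filling.
plugJobs-fill : ∀ C L → plugJobs C L ≡ fill C (jobsFilling L)
plugJobs-fill C []      = sym (fill-nothing C)
plugJobs-fill C (j ∷ L) = begin
  plugJobs (C ⟮ jname j ← M ⟯) L                  ≡⟨ plugJobs-fill _ L ⟩
  fill (C ⟮ jname j ← M ⟯) (jobsFilling L)        ≡⟨ fill-⟮←⟯ C (jname j) M _ ⟩
  fill C (extend (jobsFilling L) (jname j) (fill M _)) ≡⟨ cong (fill C ∘ extend _ (jname j)) (fill-toMC (rbJ j) _) ⟩
  fill C (jobsFilling (j ∷ L))                          ∎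
  where
    open ≡-Reasoning
    M = toMC (rbJ j)

jname-injective : ∀ {L} → Unique (map jname L) → ∀ {j k} → j ∈ L → k ∈ L → jname j ≡ jname k → j ≡ k
jname-injective u       (here refl) (here refl) e = refl
jname-injective (a ∷ u) (here refl) (there q)   e = ⊥-elim (All.lookup a (∈-map⁺ jname q) e)
jname-injective (a ∷ u) (there p)   (here refl) e = ⊥-elim (All.lookup a (∈-map⁺ jname p) (sym e))
jname-injective (_ ∷ u) (there p)   (there q)   e = jname-injective u p q e

jobsFilling-∈ : ∀ {L} → Unique (map jname L) → ∀ {j} → j ∈ L → jobsFilling L (jname j) ≡ just (toMC (rbJ j))
jobsFilling-∈ (_ ∷ _) {j} (here refl) rewrite ≡ᵇ-refl (jname j) = refl
jobsFilling-∈ {k ∷ _} (a ∷ u) {j} (there p) with jname j ≡ᵇ jname k in eq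
... | true  = ⊥-elim (All.lookup a (∈-map⁺ jname p) (sym (≡ᵇ-true⇒≡ _ _ eq)))
... | false = jobsFilling-∈ u p

jobsFilling-just : ∀ L {β M} → jobsFilling L β ≡ just M → ∃ λ j → j ∈ L × jname j ≡ β
jobsFilling-just (k ∷ L) {β} e with β ≡ᵇ jname k in eq
... | true  = k , here refl , sym (≡ᵇ-true⇒≡ _ _ eq)
... | false = let j , j∈ , e' = jobsFilling-just L e in j , there j∈ , e'

jobsFilling-agree : ∀ {L L' β} → Unique (map jname L) → Unique (map jname L') →
                    (∀ {k} → k ∈ L  → jname k ≡ β → k ∈ L') →
                    (∀ {k} → k ∈ L' → jname k ≡ β → k ∈ L) →
                    jobsFilling L β ≡ jobsFilling L' β
jobsFilling-agree {L} {L'} {β} u u' L⊆L' L'⊆L with jobsFilling L β in e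
... | just M with jobsFilling-just L e
...   | j , j∈ , refl = trans (trans (sym e) (jobsFilling-∈ u j∈)) (sym (jobsFilling-∈ u' (L⊆L' j∈ refl)))
jobsFilling-agree {L} {L'} {β} u u' L⊆L' L'⊆L | nothing with jobsFilling L' β in e'
... | nothing = refl
... | just M' with jobsFilling-just L' e'
...   | j , j∈ , refl with trans (sym (jobsFilling-∈ u (L'⊆L j∈ refl))) e
...     | ()

bvJ : Job → List Var
bvJ (job t S α) = bv t ++ concatMap bv S

fvJ : Job → List Var
fvJ (job t S α) = fv t ++ concatMap fv S

record Hygienic (L : List Job) (E : Env) : Set where
  field
    well-named   : ∀ {j} → j ∈ L → Unique (bvJ j)
    bv-disjoint  : ∀ {j k} → j ∈ L → k ∈ L → j ≢ k → Disjoint (bvJ j) (bvJ k)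
    bv-∉fv       : ∀ {j k} → j ∈ L → k ∈ L → Disjoint (bvJ j) (fvJ k)
    env-hygienic : EnvHygienic E
    bv-∉dom      : ∀ {j} → j ∈ L → Disjoint (bvJ j) (dom E)
    bv-∉env      : ∀ {j} → j ∈ L → ∀ {y u} → (y , u) ∈ E → Disjoint (bvJ j) (fv u)

module _ {L Q N : List Job} {E : Env} {j : Job} (H : Hygienic L E) (j∈L : j ∈ L)
         (Q⊆ : ∀ {k} → k ∈ Q → (k ∈ L × k ≢ j) ⊎ k ∈ N) where
  open Hygienic H

  Hygienic-replace :
    (∀ {n} → n ∈ N → Unique (bvJ n)) →
    (∀ {n k} → n ∈ N → k ∈ L → k ≢ j → Disjoint (bvJ n) (bvJ k)) →
    (∀ {n n'} → n ∈ N → n' ∈ N → n ≢ n' → Disjoint (bvJ n) (bvJ n')) →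
    (∀ {n k} → n ∈ N → k ∈ L → k ≢ j → Disjoint (bvJ k) (fvJ n)) →
    (∀ {n k} → n ∈ N → k ∈ L → k ≢ j → Disjoint (bvJ n) (fvJ k)) →
    (∀ {n n'} → n ∈ N → n' ∈ N → Disjoint (bvJ n) (fvJ n')) →
    (∀ {n} → n ∈ N → Disjoint (bvJ n) (dom E)) →
    (∀ {n} → n ∈ N → ∀ {y u} → (y , u) ∈ E → Disjoint (bvJ n) (fv u)) →
    Hygienic Q E
  Hygienic-replace N-wn N#L N#N L#fvN N#fvL N#fvN N#dom N#env = record
    { well-named   = by-origin well-named N-wn
    ; bv-disjoint  = λ k∈ k'∈ → disjoint (Q⊆ k∈) (Q⊆ k'∈)
    ; bv-∉fv       = λ k∈ k'∈ → not-free (Q⊆ k∈) (Q⊆ k'∈)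
    ; env-hygienic = env-hygienic
    ; bv-∉dom      = by-origin bv-∉dom N#dom
    ; bv-∉env      = by-origin bv-∉env N#env
    }
    where
      by-origin : ∀ {P : Job → Set} → (∀ {k} → k ∈ L → P k) → (∀ {k} → k ∈ N → P k) →
                  ∀ {k} → k ∈ Q → P k
      by-origin old new k∈ with Q⊆ k∈
      ... | inj₁ (p , _) = old p
      ... | inj₂ p       = new p
      disjoint : ∀ {k k'} → (k ∈ L × k ≢ j) ⊎ k ∈ N → (k' ∈ L × k' ≢ j) ⊎ k' ∈ N →
                 k ≢ k' → Disjoint (bvJ k) (bvJ k')
      disjoint (inj₁ (p , _))  (inj₁ (q , _))  ne = bv-disjoint p q ne
      disjoint (inj₁ (p , ne)) (inj₂ q)        _  = N#L q p ne ∘ swap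
      disjoint (inj₂ p)        (inj₁ (q , ne)) _  = N#L p q ne
      disjoint (inj₂ p)        (inj₂ q)        ne = N#N p q ne
      not-free : ∀ {k k'} → (k ∈ L × k ≢ j) ⊎ k ∈ N → (k' ∈ L × k' ≢ j) ⊎ k' ∈ N →
                 Disjoint (bvJ k) (fvJ k')
      not-free (inj₁ (p , _))  (inj₁ (q , _))  = bv-∉fv p q
      not-free (inj₁ (p , ne)) (inj₂ q)        = L#fvN q p ne
      not-free (inj₂ p)        (inj₁ (q , ne)) = N#fvL p q ne
      not-free (inj₂ p)        (inj₂ q)        = N#fvN p q

  -- X collects the variables bound in j whose binders the new jobs have dropped (the λ of sea_λ and β).
  Hygienic-carve : (X : List Var) → X ⊆ bvJ j →
    (∀ {n} → n ∈ N → Unique (bvJ n)) →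
    (∀ {n n'} → n ∈ N → n' ∈ N → n ≢ n' → Disjoint (bvJ n) (bvJ n')) →
    (∀ {n} → n ∈ N → bvJ n ⊆ bvJ j) →
    (∀ {n} → n ∈ N → ∀ {x} → x ∈ fvJ n → x ∈ X ⊎ x ∈ fvJ j) →
    (∀ {n} → n ∈ N → Disjoint (bvJ n) X) →
    Hygienic Q E
  Hygienic-carve X X⊆ N-wn N#N N⊆j fvN⊆ N#X = Hygienic-replace N-wn
    (λ n k k≢j (x∈n , x∈k) → bv-disjoint j∈L k (k≢j ∘ sym) (N⊆j n x∈n , x∈k))
    N#N
    (λ n k k≢j (x∈k , x∈n) → old-∉ k k≢j x∈k (fvN⊆ n x∈n))
    (λ n k _ (x∈n , x∈k) → bv-∉fv j∈L k (N⊆j n x∈n , x∈k))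
    (λ n n' (x∈n , x∈n') → new-∉ n x∈n (fvN⊆ n' x∈n'))
    (λ n (x∈n , x∈E) → bv-∉dom j∈L (N⊆j n x∈n , x∈E))
    (λ n yu (x∈n , x∈u) → bv-∉env j∈L yu (N⊆j n x∈n , x∈u))
    where
      old-∉ : ∀ {k} → k ∈ L → k ≢ j → ∀ {x} → x ∈ bvJ k → ¬ (x ∈ X ⊎ x ∈ fvJ j)
      old-∉ k k≢j x∈k (inj₁ x∈X) = bv-disjoint k j∈L k≢j (x∈k , X⊆ x∈X)
      old-∉ k k≢j x∈k (inj₂ x∈j) = bv-∉fv k j∈L (x∈k , x∈j)
      new-∉ : ∀ {n} → n ∈ N → ∀ {x} → x ∈ bvJ n → ¬ (x ∈ X ⊎ x ∈ fvJ j)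
      new-∉ n x∈n (inj₁ x∈X) = N#X n (x∈n , x∈X)
      new-∉ n x∈n (inj₂ x∈j) = bv-∉fv j∈L j∈L (N⊆j n x∈n , x∈j)

Hygienic-bind : ∀ {L E x u} → Hygienic L E → EnvHygienic ((x , u) ∷ E) →
                (∀ {k} → k ∈ L → ∀ {y} → y ∈ bvJ k → y ≢ x × y ∉ fv u) → Hygienic L ((x , u) ∷ E)
Hygienic-bind {L} {E} {x} {u} H hyg fresh-xu = record
  { well-named = well-named ; bv-disjoint = bv-disjoint ; bv-∉fv = bv-∉fv
  ; env-hygienic = hyg ; bv-∉dom = ∉dom ; bv-∉env = ∉env }
  where
    open Hygienic H
    ∉dom : ∀ {k} → k ∈ L → Disjoint (bvJ k) (dom ((x , u) ∷ E))
    ∉dom k (y∈k , here y≡x)  = proj₁ (fresh-xu k y∈k) y≡x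
    ∉dom k (y∈k , there y∈E) = bv-∉dom k (y∈k , y∈E)
    ∉env : ∀ {k} → k ∈ L → ∀ {y v} → (y , v) ∈ (x , u) ∷ E → Disjoint (bvJ k) (fv v)
    ∉env k (here refl) (z∈k , z∈u) = proj₂ (fresh-xu k z∈k) z∈u
    ∉env k (there yv)  = bv-∉env k yv

Hygienic-replace-one : ∀ {L Q E j n} (H : Hygienic L E) → j ∈ L →
  (∀ {k} → k ∈ Q → (k ∈ L × k ≢ j) ⊎ k ∈ n ∷ []) →
  Unique (bvJ n) →
  (∀ {k} → k ∈ L → k ≢ j → Disjoint (bvJ n) (bvJ k)) →
  (∀ {k} → k ∈ L → k ≢ j → Disjoint (bvJ k) (fvJ n)) →
  (∀ {k} → k ∈ L → k ≢ j → Disjoint (bvJ n) (fvJ k)) →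
  Disjoint (bvJ n) (fvJ n) →
  Disjoint (bvJ n) (dom E) →
  (∀ {y u} → (y , u) ∈ E → Disjoint (bvJ n) (fv u)) →
  Hygienic Q E
Hygienic-replace-one H j∈ Q⊆ wn n#L L#fvn n#fvL n#fvn n#dom n#env =
  Hygienic-replace H j∈ Q⊆ (λ { (here refl) → wn }) (λ { (here refl) → n#L })
    (λ { (here refl) (here refl) n≢n → ⊥-elim (n≢n refl) })
    (λ { (here refl) → L#fvn }) (λ { (here refl) → n#fvL }) (λ { (here refl) (here refl) → n#fvn })
    (λ { (here refl) → n#dom }) (λ { (here refl) → n#env })

Hygienic-carve-one : ∀ {L Q E j n} (H : Hygienic L E) → j ∈ L →
  (∀ {k} → k ∈ Q → (k ∈ L × k ≢ j) ⊎ k ∈ n ∷ []) →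
  (X : List Var) → X ⊆ bvJ j → Unique (bvJ n) → bvJ n ⊆ bvJ j →
  (∀ {x} → x ∈ fvJ n → x ∈ X ⊎ x ∈ fvJ j) → Disjoint (bvJ n) X →
  Hygienic Q E
Hygienic-carve-one H j∈ Q⊆ X X⊆ wn n⊆j fvn⊆ n#X =
  Hygienic-carve H j∈ Q⊆ X X⊆ (λ { (here refl) → wn })
    (λ { (here refl) (here refl) n≢n → ⊥-elim (n≢n refl) })
    (λ { (here refl) → n⊆j }) (λ { (here refl) → fvn⊆ }) (λ { (here refl) → n#X })

bv⊆vars : ∀ t → bv t ⊆ vars t
bv⊆vars (lam y t) (here e)  = here e
bv⊆vars (lam y t) (there p) = there (bv⊆vars t p)
bv⊆vars (app t u) p with ∈-++⁻ (bv t) p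
... | inj₁ q = ∈-++⁺ˡ (bv⊆vars t q)
... | inj₂ q = ∈-++⁺ʳ (vars t) (bv⊆vars u q)

fv⊆vars : ∀ t → fv t ⊆ vars t
fv⊆vars (var x)   p = p
fv⊆vars (lam y t) p = there (fv⊆vars t (proj₁ (∈-fv-lam⁻ {t = t} p)))
fv⊆vars (app t u) p with ∈-++⁻ (fv t) p
... | inj₁ q = ∈-++⁺ˡ (fv⊆vars t q)
... | inj₂ q = ∈-++⁺ʳ (vars t) (fv⊆vars u q)

argJobs : List Tm → List Name → List Job
argJobs ts βs = zipWith (λ t β → job t [] β) ts βs

jname-argJobs : ∀ ts βs → length ts ≡ length βs → map jname (argJobs ts βs) ≡ βs
jname-argJobs []       []       _ = refl
jname-argJobs (t ∷ ts) (β ∷ βs) e = cong (β ∷_) (jname-argJobs ts βs (suc-injective e))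

∈-argJobs : ∀ {ts βs n} → n ∈ argJobs ts βs → ∃ λ t → t ∈ ts × ∃ λ β → n ≡ job t [] β
∈-argJobs {t ∷ ts} {β ∷ βs} (here refl) = t , here refl , β , refl
∈-argJobs {t ∷ ts} {β ∷ βs} (there p) =
  let t' , t'∈ , β' , e = ∈-argJobs {ts} {βs} p in t' , there t'∈ , β' , e

bvJ-argJobs : ∀ {ts βs n} → n ∈ argJobs ts βs → bvJ n ⊆ concatMap bv ts
bvJ-argJobs p q with ∈-argJobs p
... | t , t∈ , β , refl = ∈-concatMap-intro bv t∈ (∈-++-[] (bv t) q)

fvJ-argJobs : ∀ {ts βs n} → n ∈ argJobs ts βs → fvJ n ⊆ concatMap fv ts
fvJ-argJobs p q with ∈-argJobs p
... | t , t∈ , β , refl = ∈-concatMap-intro fv t∈ (∈-++-[] (fv t) q)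

argJobs-well-named : ∀ ts βs → Unique (concatMap bv ts) → ∀ {n} → n ∈ argJobs ts βs → Unique (bvJ n)
argJobs-well-named (t ∷ ts) (β ∷ βs) u (here refl) =
  subst Unique (sym (++-identityʳ (bv t))) (proj₁ (Unique-++⁻ (bv t) u))
argJobs-well-named (t ∷ ts) (β ∷ βs) u (there p) =
  argJobs-well-named ts βs (proj₁ (proj₂ (Unique-++⁻ (bv t) u))) p

argJobs-disjoint : ∀ ts βs → Unique (concatMap bv ts) →
                   ∀ {n n'} → n ∈ argJobs ts βs → n' ∈ argJobs ts βs → n ≢ n' → Disjoint (bvJ n) (bvJ n')
argJobs-disjoint (t ∷ ts) (β ∷ βs) u p p' n≢n' with Unique-++⁻ (bv t) u
argJobs-disjoint (t ∷ ts) (β ∷ βs) u (here refl) (here refl) n≢n' | _ = ⊥-elim (n≢n' refl)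
argJobs-disjoint (t ∷ ts) (β ∷ βs) u (here refl) (there p') _ | _ , _ , t#ts =
  λ (x∈t , x∈n') → t#ts (∈-++-[] (bv t) x∈t , bvJ-argJobs p' x∈n')
argJobs-disjoint (t ∷ ts) (β ∷ βs) u (there p) (here refl) _ | _ , _ , t#ts =
  λ (x∈n , x∈t) → t#ts (∈-++-[] (bv t) x∈t , bvJ-argJobs p x∈n)
argJobs-disjoint (t ∷ ts) (β ∷ βs) u (there p) (there p') n≢n' | _ , uts , _ =
  argJobs-disjoint ts βs uts p p' n≢n'

module Pool (T : PoolTemplate) where
  open PoolTemplate T

  sel-name-∉ : ∀ {P j P'} → Sel P j P' → jname j ∉ names P'
  sel-name-∉ {P} {j} s p with ∈-map⁻ jname p
  ... | k , k∈P' , e with to (sel-supp s k) k∈P'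
  ...   | k∈P , k≢j = k≢j (sym (jname-injective (supp-unique P) (sel-mem s) k∈P e))

  module _ {P j P' n} (s : Sel P j P') (same-name : jname n ≡ jname j) where
    private
      n∉ : jname n ∉ names P'
      n∉ = subst (_∉ names P') (sym same-name) (sel-name-∉ s)

    drop-supp⊆ : ∀ {k} → k ∈ supp (drop n P') → (k ∈ supp P × k ≢ j) ⊎ k ∈ n ∷ []
    drop-supp⊆ {k} p with to (drop-supp n P' n∉ k) p
    ... | here refl = inj₂ (here refl)
    ... | there q   = inj₁ (to (sel-supp s k) q)

    ∈-drop : n ∈ supp (drop n P')
    ∈-drop = from (drop-supp n P' n∉ n) (here refl)

    drop-keeps : ∀ {k} → k ∈ supp P → k ≢ j → k ∈ supp (drop n P')
    drop-keeps {k} p k≢j = from (drop-supp n P' n∉ k) (there (from (sel-supp s k) (p , k≢j)))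

  FreshNames : List Job → Pool → Set
  FreshNames Js P = Unique (map jname Js) × All (_∉ names P) (map jname Js)

  private
    add-names : ∀ j P {β} → jname j ∉ names P → β ∈ names (add j P) → β ≡ jname j ⊎ β ∈ names P
    add-names j P j∉ p with ∈-map⁻ jname p
    ... | k , k∈ , refl with to (add-supp j P j∉ k) k∈
    ...   | here refl = inj₁ refl
    ...   | there q   = inj₂ (∈-map⁺ jname q)

    FreshNames-add : ∀ j Js P → FreshNames (j ∷ Js) P → FreshNames Js (add j P)
    FreshNames-add j Js P (j∉Js ∷ u , j∉P ∷ Js∉P) =
      u , All.tabulate λ p q → clash p (add-names j P j∉P q)
      where
        clash : ∀ {β} → β ∈ map jname Js → ¬ (β ≡ jname j ⊎ β ∈ names P)
        clash p (inj₁ e) = All.lookup j∉Js p (sym e)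
        clash p (inj₂ q) = All.lookup Js∉P p q

  addL-supp⁻ : ∀ Js P → FreshNames Js P → ∀ {k} → k ∈ supp (addL Js P) → k ∈ Js ⊎ k ∈ supp P
  addL-supp⁻ []       P _  p = inj₂ p
  addL-supp⁻ (j ∷ Js) P fr {k} p with addL-supp⁻ Js (add j P) (FreshNames-add j Js P fr) p
  ... | inj₁ q = inj₁ (there q)
  ... | inj₂ q with to (add-supp j P (All.head (proj₂ fr)) k) q
  ...   | here e  = inj₁ (here e)
  ...   | there r = inj₂ r

  addL-supp⁺ : ∀ Js P → FreshNames Js P → ∀ {k} → k ∈ Js ⊎ k ∈ supp P → k ∈ supp (addL Js P)
  addL-supp⁺ []       P _  (inj₂ p) = p
  addL-supp⁺ (j ∷ Js) P fr {k} q = addL-supp⁺ Js (add j P) (FreshNames-add j Js P fr) (step q)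
    where
      j∉ = All.head (proj₂ fr)
      step : k ∈ j ∷ Js ⊎ k ∈ supp P → k ∈ Js ⊎ k ∈ supp (add j P)
      step (inj₁ (here refl)) = inj₂ (from (add-supp j P j∉ k) (here refl))
      step (inj₁ (there p))   = inj₁ p
      step (inj₂ p)           = inj₂ (from (add-supp j P j∉ k) (there p))

  module SeaVar {B P P' x ts α} (βs : List Name) (s : Sel P (job (var x) ts α) P')
                (len : length βs ≡ length ts) (uβ : Unique βs)
                (frβ : All (λ β → β ∉ names P × β ∉ holes B) βs) where
    Js = argJobs ts βs

    jname-Js : map jname Js ≡ βs
    jname-Js = jname-argJobs ts βs (sym len)

    fresh-Js : FreshNames Js P'
    fresh-Js = subst Unique (sym jname-Js) uβ ,
               subst (All (_∉ names P')) (sym jname-Js) (All.map (λ fb q → proj₁ fb (names-P'⊆ q)) frβ)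
      where
        names-P'⊆ : ∀ {β} → β ∈ names P' → β ∈ names P
        names-P'⊆ q with ∈-map⁻ jname q
        ... | k , k∈ , refl = ∈-map⁺ jname (proj₁ (to (sel-supp s k) k∈))

    addL-supp⊆ : ∀ {k} → k ∈ supp (addL Js P') → (k ∈ supp P × k ≢ job (var x) ts α) ⊎ k ∈ Js
    addL-supp⊆ {k} p with addL-supp⁻ Js P' fresh-Js p
    ... | inj₁ q = inj₂ q
    ... | inj₂ q = inj₁ (to (sel-supp s k) q)

    addL-new : ∀ {k} → k ∈ Js → k ∈ supp (addL Js P')
    addL-new q = addL-supp⁺ Js P' fresh-Js (inj₁ q)

    addL-keeps : ∀ {k} → k ∈ supp P → k ≢ job (var x) ts α → k ∈ supp (addL Js P')
    addL-keeps {k} q k≢j = addL-supp⁺ Js P' fresh-Js (inj₂ (from (sel-supp s k) (q , k≢j)))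

    new-name-∉holes : ∀ {k β} → k ∈ Js → jname k ≡ β → β ∉ holes B
    new-name-∉holes k∈ refl = proj₂ (All.lookup frβ (subst (_ ∈_) jname-Js (∈-map⁺ jname k∈)))

  HygienicState : State T → Set
  HygienicState ⟪ B , P , E ⟫ = Hygienic (supp P) E

  Hygienic-seaApp : ∀ {P P' E t u S α} → Sel P (job (app t u) S α) P' →
                    Hygienic (supp P) E → Hygienic (supp (drop (job t (u ∷ S) α) P')) E
  Hygienic-seaApp {t = t} {u} {S} s H =
    Hygienic-carve-one H (sel-mem s) (drop-supp⊆ s refl) [] (λ ())
      (subst Unique bv-eq (well-named (sel-mem s))) (subst (_ ∈_) (sym bv-eq))
      (inj₂ ∘ subst (_ ∈_) (sym (++-assoc (fv t) (fv u) (concatMap fv S)))) (λ { (_ , ()) })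
    where
      open Hygienic H
      bv-eq = ++-assoc (bv t) (bv u) (concatMap bv S)

  Hygienic-seaLam : ∀ {P P' E x t α} → Sel P (job (lam x t) [] α) P' →
                    Hygienic (supp P) E → Hygienic (supp (drop (job t [] α) P')) E
  Hygienic-seaLam {x = x} {t} s H =
    Hygienic-carve-one H (sel-mem s) (drop-supp⊆ s refl) (x ∷ []) (λ { (here refl) → here refl })
      (AllPairs.tail (well-named (sel-mem s))) there fv⊆
      (λ { (y∈ , here refl) → Unique[x∷xs]⇒x∉xs (well-named (sel-mem s)) y∈ })
    where
      open Hygienic H
      fv⊆ : ∀ {y} → y ∈ fv t ++ [] → y ∈ x ∷ [] ⊎ y ∈ fv (lam x t) ++ []
      fv⊆ {y} p with y ≟ x
      ... | yes y≡x = inj₁ (here y≡x)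
      ... | no  y≢x = inj₂ (∈-++⁺ˡ (∈-fv-lam⁺ {t = t} (∈-++-[] (fv t) p) y≢x))

  Hygienic-beta : ∀ {P P' E x t u S α} → Sel P (job (lam x t) (u ∷ S) α) P' →
                  Hygienic (supp P) E → Hygienic (supp (drop (job t S α) P')) ((x , u) ∷ E)
  Hygienic-beta {P} {P'} {E} {x} {t} {u} {S} {α} s H =
    Hygienic-bind H' (env-hygienic , x∉u , λ yv → bv-∉env j∈ yv ∘ (here refl ,_)) fresh-xu
    where
      open Hygienic H
      j∈ = sel-mem s
      n = job t S α
      n⊆j : bvJ n ⊆ bv t ++ bv u ++ concatMap bv S
      n⊆j p with ∈-++⁻ (bv t) p
      ... | inj₁ q = ∈-++⁺ˡ q
      ... | inj₂ q = ∈-++⁺ʳ (bv t) (∈-++⁺ʳ (bv u) q)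
      fv⊆ : ∀ {y} → y ∈ fvJ n → y ∈ x ∷ [] ⊎ y ∈ fvJ (job (lam x t) (u ∷ S) α)
      fv⊆ {y} p with ∈-++⁻ (fv t) p
      ... | inj₂ q = inj₂ (∈-++⁺ʳ (fv (lam x t)) (∈-++⁺ʳ (fv u) q))
      ... | inj₁ q with y ≟ x
      ...   | yes y≡x = inj₁ (here y≡x)
      ...   | no  y≢x = inj₂ (∈-++⁺ˡ (∈-fv-lam⁺ {t = t} q y≢x))
      x∉n : x ∉ bvJ n
      x∉n = Unique[x∷xs]⇒x∉xs (well-named j∈) ∘ n⊆j
      H' : Hygienic (supp (drop n P')) E
      H' = Hygienic-carve-one H j∈ (drop-supp⊆ s refl) (x ∷ []) (λ { (here refl) → here refl })
             (Unique-++-drop-middle (bv t) (bv u) (AllPairs.tail (well-named j∈))) (there ∘ n⊆j) fv⊆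
             (λ { (y∈ , here refl) → x∉n y∈ })
      u⊆j : fv u ⊆ fvJ (job (lam x t) (u ∷ S) α)
      u⊆j = ∈-++⁺ʳ (fv (lam x t)) ∘ ∈-++⁺ˡ
      x∉u : x ∉ fv u
      x∉u p = bv-∉fv j∈ j∈ (here refl , u⊆j p)
      fresh-xu : ∀ {k} → k ∈ supp (drop n P') → ∀ {y} → y ∈ bvJ k → y ≢ x × y ∉ fv u
      fresh-xu k∈ y∈ with drop-supp⊆ s refl k∈
      ... | inj₁ (k∈P , k≢j) = (λ { refl → bv-disjoint j∈ k∈P (k≢j ∘ sym) (here refl , y∈) }) ,
                               (λ q → bv-∉fv k∈P j∈ (y∈ , u⊆j q))
      ... | inj₂ (here refl) = (λ { refl → x∉n y∈ }) , (λ q → bv-∉fv j∈ j∈ (there (n⊆j y∈) , u⊆j q))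

  bvJ⊆varsJob : ∀ j → bvJ j ⊆ varsJob T j
  bvJ⊆varsJob (job t S α) p with ∈-++⁻ (bv t) p
  ... | inj₁ q = ∈-++⁺ˡ (bv⊆vars t q)
  ... | inj₂ q = ∈-++⁺ʳ (vars t) (concatMap-mono bv vars bv⊆vars S q)

  fvJ⊆varsJob : ∀ j → fvJ j ⊆ varsJob T j
  fvJ⊆varsJob (job t S α) p with ∈-++⁻ (fv t) p
  ... | inj₁ q = ∈-++⁺ˡ (fv⊆vars t q)
  ... | inj₂ q = ∈-++⁺ʳ (vars t) (concatMap-mono fv vars fv⊆vars S q)

  module StateVars (B : MC) (P : Pool) (E : Env) where

    ∈-stateVars-job : ∀ {j x} → j ∈ supp P → x ∈ varsJob T j → x ∈ stateVars T ⟪ B , P , E ⟫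
    ∈-stateVars-job j∈ q = ∈-++⁺ʳ (varsMC B) (∈-++⁺ˡ (∈-concatMap-intro (varsJob T) j∈ q))

    ∈-stateVars-dom : ∀ {x} → x ∈ dom E → x ∈ stateVars T ⟪ B , P , E ⟫
    ∈-stateVars-dom p = ∈-++⁺ʳ (varsMC B) (∈-++⁺ʳ (concatMap (varsJob T) (supp P)) (∈-++⁺ˡ p))

    ∈-stateVars-env : ∀ {x y u} → (y , u) ∈ E → x ∈ vars u → x ∈ stateVars T ⟪ B , P , E ⟫
    ∈-stateVars-env yu q = ∈-++⁺ʳ (varsMC B) (∈-++⁺ʳ (concatMap (varsJob T) (supp P))
                             (∈-++⁺ʳ (dom E) (∈-concatMap-intro (λ p → vars (proj₂ p)) yu q)))

  Hygienic-sub : ∀ {B P P' E x u t' S α} → Sel P (job (var x) S α) P' →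
                 lookupE E x ≡ just u → FreshRenaming T ⟪ B , P , E ⟫ u t' →
                 Hygienic (supp P) E → Hygienic (supp (drop (job t' S α) P')) E
  Hygienic-sub {B} {P} {P'} {E} {x} {u} {t'} {S} {α} s look (t'≃u , t'-wn , t'-fresh) H =
    Hygienic-replace-one H j∈ (drop-supp⊆ s refl) n-wn n#L L#fvn n#fvL n#fvn n#dom n#env
    where
      open Hygienic H
      open StateVars B P E
      j∈ = sel-mem s
      j = job (var x) S α
      n = job t' S α
      xu∈E = lookupE-∈ E look
      t'-fresh-∉ : ∀ {y} → y ∈ bv t' → y ∉ stateVars T ⟪ B , P , E ⟫
      t'-fresh-∉ = All.lookup t'-fresh
      fv-t'⊆ : fv t' ⊆ fv u
      fv-t'⊆ p with fv-≃ t' u t'≃u p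
      ... | _ , nil , q = q
      n-wn : Unique (bvJ n)
      n-wn = ++⁺ t'-wn (well-named j∈) λ (p , q) → t'-fresh-∉ p (∈-stateVars-job j∈ (bvJ⊆varsJob j q))
      n#L : ∀ {k} → k ∈ supp P → k ≢ j → Disjoint (bvJ n) (bvJ k)
      n#L {k} k∈ k≢j (p , q) with ∈-++⁻ (bv t') p
      ... | inj₁ r = t'-fresh-∉ r (∈-stateVars-job k∈ (bvJ⊆varsJob k q))
      ... | inj₂ r = bv-disjoint j∈ k∈ (k≢j ∘ sym) (r , q)
      L#fvn : ∀ {k} → k ∈ supp P → k ≢ j → Disjoint (bvJ k) (fvJ n)
      L#fvn k∈ _ (p , q) with ∈-++⁻ (fv t') q
      ... | inj₁ r = bv-∉env k∈ xu∈E (p , fv-t'⊆ r)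
      ... | inj₂ r = bv-∉fv k∈ j∈ (p , there r)
      n#fvL : ∀ {k} → k ∈ supp P → k ≢ j → Disjoint (bvJ n) (fvJ k)
      n#fvL {k} k∈ _ (p , q) with ∈-++⁻ (bv t') p
      ... | inj₁ r = t'-fresh-∉ r (∈-stateVars-job k∈ (fvJ⊆varsJob k q))
      ... | inj₂ r = bv-∉fv j∈ k∈ (r , q)
      n#fvn : Disjoint (bvJ n) (fvJ n)
      n#fvn (p , q) with ∈-++⁻ (bv t') p | ∈-++⁻ (fv t') q
      ... | inj₁ r | inj₁ r' = t'-fresh-∉ r (∈-stateVars-env xu∈E (fv⊆vars u (fv-t'⊆ r')))
      ... | inj₁ r | inj₂ r' = t'-fresh-∉ r (∈-stateVars-job j∈ (fvJ⊆varsJob j (there r')))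
      ... | inj₂ r | inj₁ r' = bv-∉env j∈ xu∈E (r , fv-t'⊆ r')
      ... | inj₂ r | inj₂ r' = bv-∉fv j∈ j∈ (r , there r')
      n#dom : Disjoint (bvJ n) (dom E)
      n#dom (p , q) with ∈-++⁻ (bv t') p
      ... | inj₁ r = t'-fresh-∉ r (∈-stateVars-dom q)
      ... | inj₂ r = bv-∉dom j∈ (r , q)
      n#env : ∀ {y v} → (y , v) ∈ E → Disjoint (bvJ n) (fv v)
      n#env {v = v} yv (p , q) with ∈-++⁻ (bv t') p
      ... | inj₁ r = t'-fresh-∉ r (∈-stateVars-env yv (fv⊆vars v q))
      ... | inj₂ r = bv-∉env j∈ yv (r , q)

  Hygienic-seaVar : ∀ {B P P' E x ts α} (βs : List Name) (s : Sel P (job (var x) ts α) P')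
                    (len : length βs ≡ length ts) (uβ : Unique βs)
                    (frβ : All (λ β → β ∉ names P × β ∉ holes B) βs) →
                    Hygienic (supp P) E → Hygienic (supp (addL (argJobs ts βs) P')) E
  Hygienic-seaVar {B} {ts = ts} βs s len uβ frβ H =
    Hygienic-carve H (sel-mem s) addL-supp⊆ [] (λ ())
      (argJobs-well-named ts βs (well-named (sel-mem s))) (argJobs-disjoint ts βs (well-named (sel-mem s)))
      bvJ-argJobs (λ p q → inj₂ (there (fvJ-argJobs p q))) (λ _ → λ { (_ , ()) })
    where
      open Hygienic H
      open SeaVar {B} βs s len uβ frβ

  Hygienic-step : ∀ {s s'} → HygienicState s → Step T s s' → HygienicState s'
  Hygienic-step H                 (o (seaApp s))                 = Hygienic-seaApp s H
  Hygienic-step {⟪ B , _ , _ ⟫} H (o (sub s look fr))            = Hygienic-sub {B} s look fr H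
  Hygienic-step H                 (o (seaLam s))                 = Hygienic-seaLam s H
  Hygienic-step {⟪ B , _ , _ ⟫} H (o (seaVar βs s _ len uβ frβ)) = Hygienic-seaVar {B} βs s len uβ frβ H
  Hygienic-step H                 (b (beta s))                   = Hygienic-beta s H

  Hygienic-initial : ∀ {s} → Initial T s → HygienicState s
  Hygienic-initial (t , α , refl , wn , bv∉fv) = record
    { well-named   = λ k∈ → well-named₀ (only k∈)
    ; bv-disjoint  = λ k∈ k'∈ k≢k' → ⊥-elim (k≢k' (trans (only k∈) (sym (only k'∈))))
    ; bv-∉fv       = λ k∈ k'∈ → bv-∉fv₀ (only k∈) (only k'∈)
    ; env-hygienic = tt
    ; bv-∉dom      = λ _ → λ { (_ , ()) }
    ; bv-∉env      = λ _ ()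
    }
    where
      j₀ = job t [] α
      only : ∀ {k} → k ∈ supp (new j₀) → k ≡ j₀
      only {k} p with to (new-supp j₀ k) p
      ... | here e = e
      well-named₀ : ∀ {k} → k ≡ j₀ → Unique (bvJ k)
      well-named₀ refl = subst Unique (sym (++-identityʳ (bv t))) wn
      bv-∉fv₀ : ∀ {k k'} → k ≡ j₀ → k' ≡ j₀ → Disjoint (bvJ k) (fvJ k')
      bv-∉fv₀ refl refl (p , q) = All.lookup bv∉fv (∈-++-[] (bv t) p) (∈-++-[] (fv t) q)

  Hygienic-reachable : ∀ {s} → Reachable T s → HygienicState s
  Hygienic-reachable (s₀ , init , steps) = go (Hygienic-initial init) steps
    where
      go : ∀ {s s'} → HygienicState s → Star (Step T) s s' → HygienicState s'
      go H ε            = H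
      go H (step ◅ steps) = go (Hygienic-step H step) steps

  filling : Pool → Env → Filling
  filling P E = jobsFilling (map (_↓J E) (supp P))

  rb-fill : ∀ B P E → rb T ⟪ B , P , E ⟫ ≡ fill B (filling P E)
  rb-fill B P E = plugJobs-fill B (map (_↓J E) (supp P))

  private
    unique-names-↓ : ∀ E P → Unique (map jname (map (_↓J E) (supp P)))
    unique-names-↓ E P = subst Unique (map-∘ (supp P)) (supp-unique P)

  filling-∈ : ∀ E P {j} → j ∈ supp P → filling P E (jname j) ≡ just (toMC (rbJ (j ↓J E)))
  filling-∈ E P j∈ = jobsFilling-∈ (unique-names-↓ E P) (∈-map⁺ (_↓J E) j∈)

  filling-agree : ∀ E P Q {β} → (∀ {k} → k ∈ supp P → jname k ≡ β → k ∈ supp Q) →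
                  (∀ {k} → k ∈ supp Q → jname k ≡ β → k ∈ supp P) → filling P E β ≡ filling Q E β
  filling-agree E P Q P⊆Q Q⊆P =
    jobsFilling-agree (unique-names-↓ E P) (unique-names-↓ E Q) (lift P⊆Q) (lift Q⊆P)
    where
      lift : ∀ {P Q β} → (∀ {k} → k ∈ supp P → jname k ≡ β → k ∈ supp Q) →
             ∀ {k} → k ∈ map (_↓J E) (supp P) → jname k ≡ β → k ∈ map (_↓J E) (supp Q)
      lift P⊆Q p e with ∈-map⁻ (_↓J E) p
      ... | k , k∈ , refl = ∈-map⁺ (_↓J E) (P⊆Q k∈ e)

  filling-drop : ∀ {P j P' n} E → Sel P j P' → jname n ≡ jname j →
                 ∀ {β} → β ≢ jname j → filling P E β ≡ filling (drop n P') E β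
  filling-drop {P} {j} {P'} {n} E s same-name {β} β≢j = filling-agree E P (drop n P') P⊆ ⊆P
    where
      P⊆ : ∀ {k} → k ∈ supp P → jname k ≡ β → k ∈ supp (drop n P')
      P⊆ k∈ refl = drop-keeps s same-name k∈ λ { refl → β≢j refl }
      ⊆P : ∀ {k} → k ∈ supp (drop n P') → jname k ≡ β → k ∈ supp P
      ⊆P k∈ e with drop-supp⊆ s same-name k∈
      ... | inj₁ (k∈P , _)  = k∈P
      ... | inj₂ (here refl) = ⊥-elim (β≢j (trans (sym e) same-name))

  rb-replace : ∀ {B P P' E j n} → Sel P j P' → jname n ≡ jname j →
               toMC (rbJ (j ↓J E)) ≈α toMC (rbJ (n ↓J E)) →
               rb T ⟪ B , P , E ⟫ ≈α rb T ⟪ B , drop n P' , E ⟫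
  rb-replace {B} {P} {P'} {E} {j} {n} s same-name j≈n
    rewrite rb-fill B P E | rb-fill B (drop n P') E =
    fill-≈α-at B (filling P E) (filling (drop n P') E) (jname j)
      (λ _ → filling-drop E s same-name) at-j
    where
      at-j : Pointwise _≈α_ (filling P E (jname j)) (filling (drop n P') E (jname j))
      at-j rewrite filling-∈ E P (sel-mem s) | sym same-name
                 | filling-∈ E (drop n P') (∈-drop s same-name) = just j≈n

  rb-refine : ∀ {B P Q E} α K → (∀ {β} → β ∈ holes B → β ≢ α → filling P E β ≡ filling Q E β) →
              Pointwise _≈α_ (filling P E α) (just (fill K (filling Q E))) →
              rb T ⟪ B , P , E ⟫ ≈α rb T ⟪ B ⟮ α ← K ⟯ , Q , E ⟫
  rb-refine {B} {P} {Q} {E} α K agree at-α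
    rewrite rb-fill B P E | rb-fill (B ⟮ α ← K ⟯) Q E | fill-⟮←⟯ B α K (filling Q E) =
    fill-≈α-at B (filling P E) (extend ρQ α (fill K ρQ)) α
      (λ {β} β∈ β≢α → trans (agree β∈ β≢α) (sym (extend-other ρQ α (fill K ρQ) β β≢α)))
      (subst (Pointwise _≈α_ (filling P E α)) (sym (extend-same ρQ α (fill K ρQ))) at-α)
    where ρQ = filling Q E

  fill-appHoles : ∀ E (ρ : Filling) h C ts βs → fill C ρ ≡ toMC h →
                  (∀ {t β} → job t [] β ∈ argJobs ts βs → ρ β ≡ just (toMC (t ↓ E))) →
                  length ts ≡ length βs → fill (appHoles T C βs) ρ ≡ toMC ⟨ h ∣ map (_↓ E) ts ⟩
  fill-appHoles E ρ h C []       []       C≡h _   _   = C≡h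
  fill-appHoles E ρ h C (t ∷ ts) (β ∷ βs) C≡h at len =
    fill-appHoles E ρ (app h (t ↓ E)) (app C (hole β)) ts βs
      (cong₂ app C≡h (cong (fillHole β) (at (here refl)))) (at ∘ there) (suc-injective len)

  rb-seaApp : ∀ {B P P' E t u S α} → Sel P (job (app t u) S α) P' →
              rb T ⟪ B , P , E ⟫ ≈α rb T ⟪ B , drop (job t (u ∷ S) α) P' , E ⟫
  rb-seaApp {B} {E = E} {t} {u} {S} s =
    rb-replace {B} {E = E} s refl (≈α-reflexive (cong (λ r → toMC ⟨ r ∣ S ↓S E ⟩) (app-↓ E t u)))

  rb-sub : ∀ {B P P' E x u t' S α} → Sel P (job (var x) S α) P' →
           lookupE E x ≡ just u → FreshRenaming T ⟪ B , P , E ⟫ u t' → EnvHygienic E →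
           rb T ⟪ B , P , E ⟫ ≈α rb T ⟪ B , drop (job t' S α) P' , E ⟫
  rb-sub {B} {E = E} {t' = t'} {S} s look (t'≃u , _) hyg =
    rb-replace {B} {E = E} s refl (⟨∣⟩-≃ (S ↓S E) (≈α-sym (↓-lookupE E t' hyg look t'≃u)))

  rb-seaLam : ∀ {B P P' E x t α} → Sel P (job (lam x t) [] α) P' → Hygienic (supp P) E →
              rb T ⟪ B , P , E ⟫ ≈α rb T ⟪ B ⟮ α ← lam x (hole α) ⟯ , drop (job t [] α) P' , E ⟫
  rb-seaLam {B} {P} {P'} {E} {x} {t} {α} s H =
    rb-refine {B} {E = E} α (lam x (hole α)) (λ _ → filling-drop E s refl) at-α
    where
      open Hygienic H
      Q = drop (job t [] α) P'
      at-α : Pointwise _≈α_ (filling P E α) (just (lam x (fillHole α (filling Q E α))))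
      at-α rewrite filling-∈ E P (sel-mem s) | filling-∈ E Q (∈-drop s refl) =
        just (lam-↓ x E t (λ x∈ → bv-∉dom (sel-mem s) (here refl , x∈))
                          (λ xu∈ x∈ → bv-∉env (sel-mem s) xu∈ (here refl , x∈)))

  rb-seaVar : ∀ {B P P' E x ts α} (βs : List Name) (s : Sel P (job (var x) ts α) P') →
              lookupE E x ≡ nothing → (len : length βs ≡ length ts) (uβ : Unique βs)
              (frβ : All (λ β → β ∉ names P × β ∉ holes B) βs) →
              rb T ⟪ B , P , E ⟫ ≈α
              rb T ⟪ B ⟮ α ← appHoles T (var x) βs ⟯ , addL (argJobs ts βs) P' , E ⟫
  rb-seaVar {B} {P} {P'} {E} {x} {ts} {α} βs s look len uβ frβ =
    rb-refine {B} {E = E} α (appHoles T (var x) βs) agree at-α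
    where
      open SeaVar {B} βs s len uβ frβ
      Q = addL Js P'
      agree : ∀ {β} → β ∈ holes B → β ≢ α → filling P E β ≡ filling Q E β
      agree β∈ β≢α = filling-agree E P Q (λ { k∈ refl → addL-keeps k∈ λ { refl → β≢α refl } }) ⊆P
        where
          ⊆P : ∀ {k} → k ∈ supp Q → jname k ≡ _ → k ∈ supp P
          ⊆P k∈ e with addL-supp⊆ k∈
          ... | inj₁ (k∈P , _) = k∈P
          ... | inj₂ k∈Js      = ⊥-elim (new-name-∉holes k∈Js e β∈)
      at-α : Pointwise _≈α_ (filling P E α) (just (fill (appHoles T (var x) βs) (filling Q E)))
      at-α rewrite filling-∈ E P (sel-mem s) | var-↓ E x look
                 | fill-appHoles E (filling Q E) (var x) (var x) ts βs refl
                                 (filling-∈ E Q ∘ addL-new) (sym len) = just ≈α-refl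

proposition4 : (T : PoolTemplate) → ∀ {s s'} →
    Reachable T s → OStep T s s' → rb T s ≈α rb T s'
proposition4 T {⟪ B , P , E ⟫} reach = by-rule
  where
    open Pool T
    H : HygienicState ⟪ B , P , E ⟫
    H = Hygienic-reachable reach
    by-rule : ∀ {s'} → OStep T ⟪ B , P , E ⟫ s' → rb T ⟪ B , P , E ⟫ ≈α rb T s'
    by-rule (seaApp s)                    = rb-seaApp {B} {E = E} s
    by-rule (sub s look fr)               = rb-sub {B} {E = E} s look fr (Hygienic.env-hygienic H)
    by-rule (seaLam s)                    = rb-seaLam {B} {E = E} s H
    by-rule (seaVar βs s look len uβ frβ) = rb-seaVar {B} {E = E} βs s look len uβ frβ
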